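{- Let $G$ and $H$ be finite simple graphs, let $\{X_v\}_{v\in V(H)}$ be a minimal induced minor model of $H$ in $G$, and let $v\in V(H)$. For every vertex $w\in X_v$ whose degree in $G[X_v]$ is one, there exists $u\in V(H)\setminus\{v\}$ such that $w$ is the only vertex of $X_v$ that has a neighbor in $X_u$.
   Context: An induced minor model of $H$ in $G$ is a collection of pairwise disjoint sets $\{X_v\}_{v\in V(H)}$ with $X_v\subseteq V(G)$, each $G[X_v]$ connected, and such that for distinct $u,v$, some vertex of $X_u$ is adjacent in $G$ to some vertex of $X_v$ if and only if $uv\in E(H)$. Writing $H'=G[\bigcup_{v\in V(H)}X_v]$, the model is minimal if for every vertex $a\in V(H')$, the graph $H'\setminus a$ does not contain a graph isomorphic to $H$ as an induced minor (obtained by deleting vertices and contracting edges). -}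

module Defs where

open import Data.Nat using (ℕ)
open import Data.Bool using (Bool; true; false)
open import Data.Fin using (Fin)
open import Data.Fin.Subset using (Subset; _∈_; _∩_; ∣_∣)
open import Data.Vec using (tabulate)
open import Data.Product using (Σ; ∃; _×_)
open import Relation.Binary.PropositionalEquality using (_≡_; _≢_)
open import Relation.Nullary using (¬_)
open import Function.Bundles using (_⇔_)

record Graph (n : ℕ) : Set where
  field
    adj    : Fin n → Fin n → Bool
    sym    : ∀ i j → adj i j ≡ adj j i
    irrefl : ∀ i → adj i i ≡ false
open Graph public

Adj : ∀ {n} → Graph n → Fin n → Fin n → Set
Adj G i j = adj G i j ≡ true

-- walks in G all of whose vertices lie in S  (i.e. walks in G[S])
data WalkIn {n} (G : Graph n) (S : Subset n) : Fin n → Fin n → Set where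
  stop : ∀ {a} → a ∈ S → WalkIn G S a a
  step : ∀ {a b c} → a ∈ S → Adj G a b → WalkIn G S b c → WalkIn G S a c

-- G[S] is connected (connected graphs are nonempty)
Connected : ∀ {n} → Graph n → Subset n → Set
Connected G S = (∃ λ a → a ∈ S) × (∀ a b → a ∈ S → b ∈ S → WalkIn G S a b)

Touches : ∀ {n} → Graph n → Subset n → Subset n → Set
Touches G A B = ∃ λ a → ∃ λ b → a ∈ A × b ∈ B × Adj G a b

record IsInducedMinorModel {n k} (G : Graph n) (H : Graph k) (X : Fin k → Subset n) : Set where
  field
    disjoint  : ∀ u v x → x ∈ X u → x ∈ X v → u ≡ v
    connected : ∀ v → Connected G (X v)
    edges     : ∀ u v → u ≢ v → (Touches G (X u) (X v) ⇔ Adj H u v)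

-- vertex x lies in H' = G[⋃_v X_v]
InUnion : ∀ {n k} → (Fin k → Subset n) → Fin n → Set
InUnion X x = ∃ λ v → x ∈ X v

-- H' \ a contains H as an induced minor: there is an induced minor model of H in G
-- all of whose branch sets lie in V(H') \ {a}  (a model in G[V(H') \ {a}])
ContainsAfterDeleting : ∀ {n k} → Graph n → Graph k → (Fin k → Subset n) → Fin n → Set
ContainsAfterDeleting G H X a =
  Σ (Fin _ → Subset _) λ Y → IsInducedMinorModel G H Y ×
    (∀ v y → y ∈ Y v → InUnion X y × y ≢ a)

record IsMinimalModel {n k} (G : Graph n) (H : Graph k) (X : Fin k → Subset n) : Set where
  field
    model   : IsInducedMinorModel G H X
    minimal : ∀ a → InUnion X a → ¬ ContainsAfterDeleting G H X a

nbhd : ∀ {n} → Graph n → Fin n → Subset n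
nbhd G w = tabulate (adj G w)

degIn : ∀ {n} → Graph n → Subset n → Fin n → ℕ
degIn G S w = ∣ nbhd G w ∩ S ∣

{-# OPTIONS --safe #-}
module Submission where

-- Deleting a leaf w of G[X v] keeps X v connected, so the sets X u - w form an
-- induced minor model of H inside H' - w unless some edge uv of H is lost, that is,
-- unless some X u (u ≠ v) is adjacent to w but to no other vertex of X v.
-- Minimality rules the smaller model out, so such a u exists (it is found by a
-- decidable search over V(H)), and it is the required one.

open import Defs hiding (sym)
open import Data.Nat using (ℕ; suc; pred)
import Data.Bool as Bool
open import Data.Fin using (Fin; zero; suc; _≟_)
open import Data.Fin.Subset using (Subset; _∈_; _∉_; _⊆_; _─_; _-_; ⁅_⁆; ∣_∣; Nonempty; inside; outside)
open import Data.Fin.Subset.Properties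
  using (_∈?_; ⊆-refl; p─q⊆p; x∈p∧x≢y⇒x∈p-y; x∉⁅y⁆⇒x≢y; x∈p∩q⁺; x∈p∩q⁻)
open import Data.Fin.Properties using (any?)
open import Data.Vec using (_∷_; here; there)
open import Data.Vec.Properties using (lookup∘tabulate; lookup⇒[]=; []=⇒lookup)
open import Data.Product using (∃; _×_; _,_)
open import Data.Empty using (⊥-elim)
open import Function using (_∘_)
open import Function.Bundles using (_⇔_; mk⇔; Equivalence)
open import Relation.Nullary using (Dec; yes; no)
open import Relation.Nullary.Decidable using (¬?; _×-dec_; decidable-stable)
open import Relation.Binary.PropositionalEquality
  using (_≡_; _≢_; refl; sym; trans; cong; subst; ≢-sym)

private
  variable
    n k : ℕ
    p q S T A A′ B B′ : Subset n
    a b c w x y : Fin n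
    H : Graph k
    X : Fin k → Subset n
    v : Fin k

∣p∣≡0⇒x∉p : ∣ p ∣ ≡ 0 → x ∉ p
∣p∣≡0⇒x∉p {p = inside ∷ p} ()
∣p∣≡0⇒x∉p {p = outside ∷ p} e (there x∈p) = ∣p∣≡0⇒x∉p e x∈p

∣p∣≡1⇒Nonempty : ∣ p ∣ ≡ 1 → Nonempty p
∣p∣≡1⇒Nonempty {p = inside ∷ p} _ = zero , here
∣p∣≡1⇒Nonempty {p = outside ∷ p} e with ∣p∣≡1⇒Nonempty e
... | x , x∈p = suc x , there x∈p

∣p∣≡1⇒x≡y : ∣ p ∣ ≡ 1 → x ∈ p → y ∈ p → x ≡ y
∣p∣≡1⇒x≡y {p = inside ∷ p} e here here = refl
∣p∣≡1⇒x≡y {p = inside ∷ p} e here (there y∈p) = ⊥-elim (∣p∣≡0⇒x∉p (cong pred e) y∈p)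
∣p∣≡1⇒x≡y {p = inside ∷ p} e (there x∈p) _ = ⊥-elim (∣p∣≡0⇒x∉p (cong pred e) x∈p)
∣p∣≡1⇒x≡y {p = outside ∷ p} e (there x∈p) (there y∈p) = cong suc (∣p∣≡1⇒x≡y e x∈p y∈p)

x∈p─q⇒x∉q : x ∈ p ─ q → x ∉ q
x∈p─q⇒x∉q {p = _ ∷ p} {q = outside ∷ q} (there x∈p─q) (there x∈q) = x∈p─q⇒x∉q {p = p} x∈p─q x∈q
x∈p─q⇒x∉q {p = _ ∷ p} {q = inside ∷ q} (there x∈p─q) (there x∈q) = x∈p─q⇒x∉q {p = p} x∈p─q x∈q

x∈p-y⇒x≢y : x ∈ p - y → x ≢ y
x∈p-y⇒x≢y {p = p} = x∉⁅y⁆⇒x≢y ∘ x∈p─q⇒x∉q {p = p}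

p-x⊆p : p - x ⊆ p
p-x⊆p {p = p} {x} = p─q⊆p p ⁅ x ⁆

NeighbourIn : Graph n → Fin n → Subset n → Set
NeighbourIn G x B = ∃ λ y → y ∈ B × Adj G x y

neighbourIn? : ∀ (G : Graph n) x B → Dec (NeighbourIn G x B)
neighbourIn? G x B = any? λ y → y ∈? B ×-dec adj G x y Bool.≟ Bool.true

touches? : ∀ (G : Graph n) A B → Dec (Touches G A B)
touches? G A B = any? λ a → any? λ b → a ∈? A ×-dec b ∈? B ×-dec adj G a b Bool.≟ Bool.true

module _ {G : Graph n} where

  Adj-sym : Adj G a b → Adj G b a
  Adj-sym {a} {b} ab = trans (Graph.sym G b a) ab

  Adj⇒≢ : Adj G a b → a ≢ b
  Adj⇒≢ {a} ab refl with () ← trans (sym ab) (irrefl G a)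

  ∈nbhd⇔Adj : x ∈ nbhd G w ⇔ Adj G w x
  ∈nbhd⇔Adj {x = x} {w} = mk⇔
    (λ x∈N → trans (sym (lookup∘tabulate (adj G w) x)) ([]=⇒lookup x∈N))
    (λ wx → lookup⇒[]= x _ (trans (lookup∘tabulate (adj G w) x) wx))

  degIn≡1⇒neighbour : degIn G S w ≡ 1 → ∃ λ z → z ∈ S × Adj G w z
  degIn≡1⇒neighbour {S = S} {w = w} deg with ∣p∣≡1⇒Nonempty deg
  ... | z , z∈N∩S = let z∈N , z∈S = x∈p∩q⁻ (nbhd G w) S z∈N∩S in
                      z , z∈S , Equivalence.to ∈nbhd⇔Adj z∈N

  degIn≡1⇒neighbour-unique : degIn G S w ≡ 1 → x ∈ S → y ∈ S → Adj G w x → Adj G w y → x ≡ y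
  degIn≡1⇒neighbour-unique deg x∈S y∈S wx wy =
    ∣p∣≡1⇒x≡y deg (x∈p∩q⁺ (Equivalence.from ∈nbhd⇔Adj wx , x∈S))
                  (x∈p∩q⁺ (Equivalence.from ∈nbhd⇔Adj wy , y∈S))

  WalkIn-source∈ : WalkIn G S a b → a ∈ S
  WalkIn-source∈ (stop a∈S) = a∈S
  WalkIn-source∈ (step a∈S _ _) = a∈S

  WalkIn-mono : S ⊆ T → WalkIn G S a b → WalkIn G T a b
  WalkIn-mono S⊆T (stop a∈S) = stop (S⊆T a∈S)
  WalkIn-mono S⊆T (step a∈S ab walk) = step (S⊆T a∈S) ab (WalkIn-mono S⊆T walk)

  Connected-resp-⊆⊇ : S ⊆ T → T ⊆ S → Connected G S → Connected G T
  Connected-resp-⊆⊇ S⊆T T⊆S ((a , a∈S) , walk) =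
    (a , S⊆T a∈S) , λ b c b∈T c∈T → WalkIn-mono S⊆T (walk b c (T⊆S b∈T) (T⊆S c∈T))

  -- A walk entering the leaf w must leave it again through its unique neighbour,
  -- which is also the vertex it came from; so that detour can be cut out.
  WalkIn-avoid-leaf : degIn G S w ≡ 1 → WalkIn G S a c → a ≢ w → c ≢ w → WalkIn G (S - w) a c
  WalkIn-avoid-leaf-after : degIn G S w ≡ 1 → a ∈ S → Adj G a b → WalkIn G S b c →
                            a ≢ w → c ≢ w → Dec (b ≡ w) → WalkIn G (S - w) a c

  WalkIn-avoid-leaf leaf (stop a∈S) a≢w _ = stop (x∈p∧x≢y⇒x∈p-y a∈S a≢w)
  WalkIn-avoid-leaf {w = w} leaf (step {b = b} a∈S ab walk) a≢w c≢w =
    WalkIn-avoid-leaf-after leaf a∈S ab walk a≢w c≢w (b ≟ w)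

  WalkIn-avoid-leaf-after leaf a∈S ab walk a≢w c≢w (no b≢w) =
    step (x∈p∧x≢y⇒x∈p-y a∈S a≢w) ab (WalkIn-avoid-leaf leaf walk b≢w c≢w)
  WalkIn-avoid-leaf-after leaf a∈S ab (stop _) a≢w c≢w (yes refl) = ⊥-elim (c≢w refl)
  WalkIn-avoid-leaf-after leaf a∈S ab (step _ wb′ walk) a≢w c≢w (yes refl) =
    subst (λ t → WalkIn G _ t _)
          (degIn≡1⇒neighbour-unique leaf (WalkIn-source∈ walk) a∈S wb′ (Adj-sym ab))
          (WalkIn-avoid-leaf leaf walk (≢-sym (Adj⇒≢ wb′)) c≢w)

  Connected-minus-leaf : degIn G S w ≡ 1 → Connected G S → Connected G (S - w)
  Connected-minus-leaf leaf (_ , walk) with degIn≡1⇒neighbour leaf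
  ... | z , z∈S , wz = (z , x∈p∧x≢y⇒x∈p-y z∈S (≢-sym (Adj⇒≢ wz))) , λ a c a∈S-w c∈S-w →
    WalkIn-avoid-leaf leaf (walk a c (p-x⊆p a∈S-w) (p-x⊆p c∈S-w))
                      (x∈p-y⇒x≢y a∈S-w) (x∈p-y⇒x≢y c∈S-w)

  Touches-mono : A ⊆ A′ → B ⊆ B′ → Touches G A B → Touches G A′ B′
  Touches-mono A⊆A′ B⊆B′ (a , b , a∈A , b∈B , ab) = a , b , A⊆A′ a∈A , B⊆B′ b∈B , ab

  Touches-sym : Touches G A B → Touches G B A
  Touches-sym (a , b , a∈A , b∈B , ab) = b , a , b∈B , a∈A , Adj-sym ab

  IsInducedMinorModel-minus : IsInducedMinorModel G H X → w ∈ X v → Connected G (X v - w) →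
                              (∀ u → u ≢ v → NeighbourIn G w (X u) → Touches G (X v - w) (X u)) →
                              IsInducedMinorModel G H (λ u → X u - w)
  IsInducedMinorModel-minus {X = X} {w = w} {v = v} model w∈Xv Xv-w-connected rerouted = record
    { disjoint  = λ u u′ x x∈Xu-w x∈Xu′-w → disjoint u u′ x (p-x⊆p x∈Xu-w) (p-x⊆p x∈Xu′-w)
    ; connected = connected-minus
    ; edges     = λ u u′ u≢u′ → mk⇔
        (Equivalence.to (edges u u′ u≢u′) ∘ Touches-mono p-x⊆p p-x⊆p)
        (touches-minus u≢u′ ∘ Equivalence.from (edges u u′ u≢u′))
    }
    where
    open IsInducedMinorModel model

    Xu⊆Xu-w : ∀ {u} → u ≢ v → X u ⊆ X u - w
    Xu⊆Xu-w u≢v x∈Xu = x∈p∧x≢y⇒x∈p-y x∈Xu λ { refl → u≢v (disjoint _ v w x∈Xu w∈Xv) }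

    connected-minus : ∀ u → Connected G (X u - w)
    connected-minus u with u ≟ v
    ... | yes refl = Xv-w-connected
    ... | no u≢v = Connected-resp-⊆⊇ (Xu⊆Xu-w u≢v) p-x⊆p (connected u)

    touches-from-w : ∀ {u b} → u ≢ v → b ∈ X u → Adj G w b → Touches G (X v - w) (X u - w)
    touches-from-w u≢v b∈Xu wb = Touches-mono ⊆-refl (Xu⊆Xu-w u≢v) (rerouted _ u≢v (_ , b∈Xu , wb))

    touches-minus : ∀ {u u′} → u ≢ u′ → Touches G (X u) (X u′) → Touches G (X u - w) (X u′ - w)
    touches-minus {u} {u′} u≢u′ (a , b , a∈Xu , b∈Xu′ , ab) with a ≟ w | b ≟ w
    ... | no a≢w | no b≢w = a , b , x∈p∧x≢y⇒x∈p-y a∈Xu a≢w , x∈p∧x≢y⇒x∈p-y b∈Xu′ b≢w , ab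
    ... | yes refl | _ with refl ← disjoint u v w a∈Xu w∈Xv = touches-from-w (≢-sym u≢u′) b∈Xu′ ab
    ... | no _ | yes refl with refl ← disjoint u′ v w b∈Xu′ w∈Xv =
      Touches-sym (touches-from-w u≢u′ a∈Xu (Adj-sym ab))

lemma4p2 : ∀ {n k} (G : Graph n) (H : Graph k) (X : Fin k → Subset n) →
           IsMinimalModel G H X → (v : Fin k) → (w : Fin n) → w ∈ X v →
           degIn G (X v) w ≡ 1 →
           ∃ λ u → u ≢ v ×
             (∀ x → x ∈ X v → ((∃ λ y → y ∈ X u × Adj G x y) ⇔ x ≡ w))
lemma4p2 G H X minimalModel v w w∈Xv leaf
  with any? (λ u → ¬? (u ≟ v) ×-dec neighbourIn? G w (X u) ×-dec ¬? (touches? G (X v - w) (X u)))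
... | yes (u , u≢v , w-sees-Xu , Xv-w-misses-Xu) = u , u≢v , λ x x∈Xv → mk⇔
  (λ (y , y∈Xu , xy) → decidable-stable (x ≟ w) λ x≢w →
     Xv-w-misses-Xu (x , y , x∈p∧x≢y⇒x∈p-y x∈Xv x≢w , y∈Xu , xy))
  (λ { refl → w-sees-Xu })
... | no no-private-neighbour =
  ⊥-elim (minimal w (v , w∈Xv) ((λ u → X u - w) , model-minus , avoids-w))
  where
  open IsMinimalModel minimalModel

  model-minus : IsInducedMinorModel G H (λ u → X u - w)
  model-minus = IsInducedMinorModel-minus model w∈Xv
    (Connected-minus-leaf leaf (IsInducedMinorModel.connected model v))
    λ u u≢v w-sees-Xu → decidable-stable (touches? G _ _) λ misses →
      no-private-neighbour (u , u≢v , w-sees-Xu , misses)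

  avoids-w : ∀ u y → y ∈ X u - w → InUnion X y × y ≢ w
  avoids-w u y y∈Xu-w = (u , p-x⊆p y∈Xu-w) , x∈p-y⇒x≢y y∈Xu-w
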